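{- Let $m\ge1$ be an integer, $p$ a prime, and $q=p^\alpha$ with $\alpha\ge1$. Then: (1) $m(q-1)+1\le U(q,m)\le mq$; (2) if $p\ge 2m-1$, then $U(q,m)=m(q-1)+1$; (3) if $m\le p\le 2m-2$, then $U(q,m)=mq+m-p$; (4) if $p\ge m$, then the roots in $\mathbb{Z}_p$ of the polynomial $\binom{t-1}{m-1}=\frac{(t-1)(t-2)\cdots(t-(m-1))}{(m-1)!}\in\mathbb{Z}_p[t]$ are exactly $1,2,\dots,m-1$.
   Context: For $q=p^\alpha$ and $m\ge1$, $U(q,m)$ is the smallest integer $t\ge m(q-1)+1$ such that $\sum_{0\le 2j\le m-1}\binom{t}{2j}\not\equiv \sum_{1\le 2j+1\le m-1}\binom{t}{2j+1}\pmod p$; equivalently, the smallest integer $t\ge m(q-1)+1$ such that $\binom{t-1}{m-1}\not\equiv 0\pmod p$. -}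

module Defs where

open import Data.Nat using (ℕ; zero; suc; _+_; _*_; _∸_; _≤_; _<_)
open import Data.Nat.Divisibility using (_∣_)
open import Data.Nat.Combinatorics using (_C_)
open import Data.Integer as ℤ using (ℤ; +_)
open import Data.Product using (_×_)
open import Relation.Nullary using (¬_)

base : ℕ → ℕ → ℕ
base q m = m * (q ∸ 1) + 1

-- the defining condition of U(q,m) (second, equivalent form in the paper):
-- binom(t-1, m-1) is not ≡ 0 mod p
UCond : ℕ → ℕ → ℕ → Set
UCond p m t = ¬ (p ∣ ((t ∸ 1) C (m ∸ 1)))

IsU : ℕ → ℕ → ℕ → ℕ → Set
IsU p q m u =
  base q m ≤ u × UCond p m u ×
  (∀ t → base q m ≤ t → t < u → ¬ UCond p m t)

prodShift : ℤ → ℕ → ℤ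
prodShift t zero = + 1
prodShift t (suc k) = prodShift t k ℤ.* (t ℤ.- + suc k)

module Submission where

-- For k < p, Pascal's rule together with p ∣ C(p,j) (0 < j < p) shows that C(n,k) mod p depends
-- only on n mod p, and for r < p we have p ∣ C(r,k) iff r < k, since otherwise C(r,k) divides r!.
-- As p ∣ q, n = m(q-1) + d has residue p - m + d for d < m ≤ p, so C(n, m-1) is divisible by p
-- exactly while p - m + d < m - 1; the first d breaking this is (m-1) ∸ (p-m), which is 0 when
-- p ≥ 2m-1 and 2m-1-p otherwise. The bound U(q,m) ≤ mq holds because, by Pascal's rule, p cannot
-- divide C(n+i, k) for all i ≤ k. Part (4) is Euclid's lemma applied to the factors t - i, each of
-- absolute value below p.

open import Data.Empty using (⊥-elim)
open import Data.Fin using (Fin; toℕ)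
open import Data.Fin.Properties using (toℕ<n)
open import Data.Integer as ℤ using (ℤ; +_)
import Data.Integer.Divisibility as ℤD
import Data.Integer.Divisibility.Signed as ℤS
import Data.Integer.Properties as ℤP
open import Data.Nat
open import Data.Nat.Combinatorics
  using (_C_; nCk≡n!/k![n-k]!; k![n∸k]!∣n!; k>n⇒nCk≡0; nCk+nC[k+1]≡[n+1]C[k+1])
open import Data.Nat.Divisibility
open import Data.Nat.DivMod
open import Data.Nat.Primality
open import Data.Nat.Properties
open import Data.Nat.Tactic.RingSolver using (solve-∀)
open import Data.Product using (∃; _×_; _,_; proj₁; map₂)
open import Data.Sum using (_⊎_; inj₁; inj₂; [_,_])
open import Function.Base using (_∘_; id)
open import Function.Bundles using (_⇔_; mk⇔; Equivalence)
open import Function.Construct.Composition using (_⇔-∘_)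
open import Relation.Binary.Definitions using (tri<; tri≈; tri>)
open import Relation.Binary.PropositionalEquality
  using (_≡_; refl; sym; trans; cong; cong₂; subst; module ≡-Reasoning)
open import Relation.Nullary
open import Relation.Unary using (Pred; Decidable)

open import Defs

least-witness-≥ : ∀ {ℓ} {P : Pred ℕ ℓ} → Decidable P → ∀ b n → P (b + n) →
  ∃ λ u → b ≤ u × u ≤ b + n × P u × (∀ t → b ≤ t → t < u → ¬ P t)
least-witness-≥ P? b n Pb+n with P? b
... | yes Pb = b , ≤-refl , m≤m+n b n , Pb , λ t b≤t t<b _ → <⇒≱ t<b b≤t
least-witness-≥ {P = P} P? b zero Pb+0 | no ¬Pb = ⊥-elim (¬Pb (subst P (+-identityʳ b) Pb+0))
least-witness-≥ {P = P} P? b (suc n) Pb+1+n | no ¬Pb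
  with least-witness-≥ P? (suc b) n (subst P (+-suc b n) Pb+1+n)
... | u , b<u , u≤1+b+n , Pu , least =
  u , <⇒≤ b<u , subst (u ≤_) (sym (+-suc b n)) u≤1+b+n , Pu , least-from-b
  where
    least-from-b : ∀ t → b ≤ t → t < u → ¬ P t
    least-from-b t b≤t t<u with m≤n⇒m<n∨m≡n b≤t
    ... | inj₁ b<t = least t b<t t<u
    ... | inj₂ refl = ¬Pb

∃[i≤k]∤[n+i]Ck : ∀ {d} → d ∤ 1 → ∀ n k → ∃ λ i → i ≤ k × d ∤ (n + i) C k
∃[i≤k]∤[n+i]Ck d∤1 n zero = 0 , z≤n , d∤1
∃[i≤k]∤[n+i]Ck {d} d∤1 n (suc k) with ∃[i≤k]∤[n+i]Ck d∤1 n k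
... | i , i≤k , d∤C[k] with d ∣? (n + i) C suc k
...   | no d∤C[1+k] = i , m≤n⇒m≤1+n i≤k , d∤C[1+k]
...   | yes d∣C[1+k] = suc i , s≤s i≤k , d∤next
  where
    pascal : (n + suc i) C suc k ≡ (n + i) C suc k + (n + i) C k
    pascal = begin
      (n + suc i) C suc k              ≡⟨ cong (_C suc k) (+-suc n i) ⟩
      suc (n + i) C suc k              ≡⟨ sym (nCk+nC[k+1]≡[n+1]C[k+1] (n + i) k) ⟩
      (n + i) C k + (n + i) C suc k    ≡⟨ +-comm ((n + i) C k) _ ⟩
      (n + i) C suc k + (n + i) C k    ∎
      where open ≡-Reasoning
    d∤next : d ∤ (n + suc i) C suc k
    d∤next d∣next = d∤C[k] (∣m+n∣m⇒∣n (subst (d ∣_) pascal d∣next) d∣C[1+k])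

nCk*[k!*[n∸k]!]≡n! : ∀ {n k} → k ≤ n → (n C k) * (k ! * (n ∸ k) !) ≡ n !
nCk*[k!*[n∸k]!]≡n! {n} {k} k≤n = begin
  (n C k) * (k ! * (n ∸ k) !)                   ≡⟨ cong (_* (k ! * (n ∸ k) !)) (nCk≡n!/k![n-k]! k≤n) ⟩
  (n ! / (k ! * (n ∸ k) !)) * (k ! * (n ∸ k) !)  ≡⟨ m/n*n≡m (k![n∸k]!∣n! k≤n) ⟩
  n !                                            ∎
  where
    open ≡-Reasoning
    instance _ = k !* (n ∸ k) !≢0

nCk∣n! : ∀ {n k} → k ≤ n → n C k ∣ n !
nCk∣n! {n} {k} k≤n =
  divides (k ! * (n ∸ k) !) (sym (trans (*-comm _ (n C k)) (nCk*[k!*[n∸k]!]≡n! k≤n)))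

n∣n! : ∀ n .{{_ : NonZero n}} → n ∣ n !
n∣n! (suc n) = m∣m*n (n !)

module _ {p : ℕ} (prime-p : Prime p) where

  private instance
    p≢0 : NonZero p
    p≢0 = prime⇒nonZero prime-p

  p∤1 : p ∤ 1
  p∤1 p∣1 = ¬prime[1] (subst Prime (∣1⇒≡1 p∣1) prime-p)

  p∤n! : ∀ {n} → n < p → p ∤ n !
  p∤n! {zero}  _   = p∤1
  p∤n! {suc n} n<p p∣n! with euclidsLemma (suc n) (n !) prime-p p∣n!
  ... | inj₁ p∣1+n = >⇒∤ n<p p∣1+n
  ... | inj₂ p∣n!′ = p∤n! (<-trans (n<1+n n) n<p) p∣n!′

  p∣pCk : ∀ {k} → 0 < k → k < p → p ∣ p C k
  p∣pCk {k} 0<k k<p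
    with euclidsLemma (p C k) (k ! * (p ∸ k) !) prime-p
           (subst (p ∣_) (sym (nCk*[k!*[n∸k]!]≡n! (<⇒≤ k<p))) (n∣n! p))
  ... | inj₁ p∣C = p∣C
  ... | inj₂ p∣k!*[p∸k]! with euclidsLemma (k !) ((p ∸ k) !) prime-p p∣k!*[p∸k]!
  ...   | inj₁ p∣k!      = ⊥-elim (p∤n! k<p p∣k!)
  ...   | inj₂ p∣[p∸k]!  = ⊥-elim (p∤n! (∸-monoʳ-< 0<k (<⇒≤ k<p)) p∣[p∸k]!)

  [n+p]Ck%p≡nCk%p : ∀ n {k} → k < p → ((n + p) C k) % p ≡ (n C k) % p
  [n+p]Ck%p≡nCk%p n       {zero}  _   = refl
  [n+p]Ck%p≡nCk%p zero    {suc k} k<p = begin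
    (p C suc k) % p  ≡⟨ n∣m⇒m%n≡0 _ p (p∣pCk z<s k<p) ⟩
    0                ≡⟨ n∣m⇒m%n≡0 0 p (p ∣0) ⟨
    0 % p            ∎
    where open ≡-Reasoning
  [n+p]Ck%p≡nCk%p (suc n) {suc k} k<p = begin
    (suc (n + p) C suc k) % p                        ≡⟨ cong (_% p) (pascal (n + p)) ⟨
    ((n + p) C k + (n + p) C suc k) % p              ≡⟨ %-distribˡ-+ ((n + p) C k) _ p ⟩
    (((n + p) C k) % p + ((n + p) C suc k) % p) % p  ≡⟨ cong₂ (λ a b → (a + b) % p)
                                                         ([n+p]Ck%p≡nCk%p n (<-trans (n<1+n k) k<p))
                                                         ([n+p]Ck%p≡nCk%p n k<p) ⟩
    ((n C k) % p + (n C suc k) % p) % p              ≡⟨ %-distribˡ-+ (n C k) _ p ⟨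
    (n C k + n C suc k) % p                          ≡⟨ cong (_% p) (pascal n) ⟩
    (suc n C suc k) % p                              ∎
    where
      open ≡-Reasoning
      pascal : ∀ n → n C k + n C suc k ≡ suc n C suc k
      pascal n = nCk+nC[k+1]≡[n+1]C[k+1] n k

  [n+a*p]Ck%p≡nCk%p : ∀ n a {k} → k < p → ((n + a * p) C k) % p ≡ (n C k) % p
  [n+a*p]Ck%p≡nCk%p n zero    {k} k<p = cong (λ x → (x C k) % p) (+-identityʳ n)
  [n+a*p]Ck%p≡nCk%p n (suc a) {k} k<p = begin
    ((n + (p + a * p)) C k) % p  ≡⟨ cong (λ x → ((n + x) C k) % p) (+-comm p (a * p)) ⟩
    ((n + (a * p + p)) C k) % p  ≡⟨ cong (λ x → (x C k) % p) (+-assoc n (a * p) p) ⟨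
    ((n + a * p + p) C k) % p    ≡⟨ [n+p]Ck%p≡nCk%p (n + a * p) k<p ⟩
    ((n + a * p) C k) % p        ≡⟨ [n+a*p]Ck%p≡nCk%p n a k<p ⟩
    (n C k) % p                  ∎
    where open ≡-Reasoning

  nCk%p≡[n%p]Ck%p : ∀ n {k} → k < p → (n C k) % p ≡ ((n % p) C k) % p
  nCk%p≡[n%p]Ck%p n {k} k<p = begin
    (n C k) % p                          ≡⟨ cong (λ x → (x C k) % p) (m≡m%n+[m/n]*n n p) ⟩
    ((n % p + (n / p) * p) C k) % p      ≡⟨ [n+a*p]Ck%p≡nCk%p (n % p) (n / p) k<p ⟩
    ((n % p) C k) % p                    ∎
    where open ≡-Reasoning

  p∣rCk⇒r<k : ∀ {r k} → r < p → p ∣ r C k → r < k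
  p∣rCk⇒r<k {r} {k} r<p p∣C with r <? k
  ... | yes r<k = r<k
  ... | no  r≮k = ⊥-elim (p∤n! r<p (∣-trans p∣C (nCk∣n! (≮⇒≥ r≮k))))

  p∣nCk⇔n%p<k : ∀ n {k} → k < p → p ∣ n C k ⇔ n % p < k
  p∣nCk⇔n%p<k n {k} k<p = mk⇔
    (λ p∣C → p∣rCk⇒r<k (m%n<n n p)
      (m%n≡0⇒n∣m _ p (trans (sym (nCk%p≡[n%p]Ck%p n k<p)) (n∣m⇒m%n≡0 _ p p∣C))))
    (λ n%p<k → m%n≡0⇒n∣m _ p (begin
      (n C k) % p          ≡⟨ nCk%p≡[n%p]Ck%p n k<p ⟩
      ((n % p) C k) % p    ≡⟨ cong (_% p) (k>n⇒nCk≡0 n%p<k) ⟩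
      0 % p                ≡⟨ n∣m⇒m%n≡0 0 p (p ∣0) ⟩
      0                    ∎))
    where open ≡-Reasoning

IsU-unique : ∀ {p} q m {u v} → IsU p q m u → IsU p q m v → u ≡ v
IsU-unique q m {u} {v} (b≤u , Uu , least-u) (b≤v , Uv , least-v) with <-cmp u v
... | tri< u<v _ _   = ⊥-elim (least-v u b≤u u<v Uu)
... | tri≈ _ u≡v _   = u≡v
... | tri> _ _ v<u   = ⊥-elim (least-u v b≤v v<u Uv)

base+d∸1≡m*[q∸1]+d : ∀ q m d → base q m + d ∸ 1 ≡ m * (q ∸ 1) + d
base+d∸1≡m*[q∸1]+d q m d =
  cong (_∸ 1) (trans (+-assoc (m * (q ∸ 1)) 1 d) (+-suc (m * (q ∸ 1)) d))

UCond-base+ : ∀ {p} q m {d} → p ∤ (m * (q ∸ 1) + d) C (m ∸ 1) → UCond p m (base q m + d)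
UCond-base+ {p} q m {d} = subst (λ n → p ∤ n C (m ∸ 1)) (sym (base+d∸1≡m*[q∸1]+d q m d))

¬UCond-base+ : ∀ {p} q m {d} → p ∣ (m * (q ∸ 1) + d) C (m ∸ 1) → ¬ UCond p m (base q m + d)
¬UCond-base+ {p} q m {d} p∣C ¬p∣C =
  ¬p∣C (subst (λ n → p ∣ n C (m ∸ 1)) (sym (base+d∸1≡m*[q∸1]+d q m d)) p∣C)

module _ {p : ℕ} (p∤1 : p ∤ 1) (q k : ℕ) where

  IsU-exists : ∃ (IsU p q (suc k))
  IsU-exists with ∃[i≤k]∤[n+i]Ck p∤1 (suc k * (q ∸ 1)) k
  ... | i , _ , p∤C
    with least-witness-≥ (λ t → ¬? (p ∣? _)) (base q (suc k)) i (UCond-base+ q (suc k) p∤C)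
  ...   | u , b≤u , _ , Uu , least = u , b≤u , Uu , least

  IsU⇒≤base+k : ∀ {u} → IsU p q (suc k) u → u ≤ base q (suc k) + k
  IsU⇒≤base+k {u} (_ , _ , least) with ∃[i≤k]∤[n+i]Ck p∤1 (suc k * (q ∸ 1)) k
  ... | i , i≤k , p∤C with u ≤? base q (suc k) + i
  ...   | yes u≤b+i = ≤-trans u≤b+i (+-monoʳ-≤ (base q (suc k)) i≤k)
  ...   | no  u≰b+i =
    ⊥-elim (least (base q (suc k) + i) (m≤m+n _ i) (≰⇒> u≰b+i) (UCond-base+ q (suc k) p∤C))

m*[q∸1]+m≡m*q : ∀ m {q} → 1 ≤ q → m * (q ∸ 1) + m ≡ m * q
m*[q∸1]+m≡m*q m {q} 1≤q = begin
  m * (q ∸ 1) + m      ≡⟨ cong (λ x → m * (q ∸ 1) + x) (*-identityʳ m) ⟨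
  m * (q ∸ 1) + m * 1  ≡⟨ *-distribˡ-+ m (q ∸ 1) 1 ⟨
  m * (q ∸ 1 + 1)      ≡⟨ cong (m *_) (m∸n+n≡m 1≤q) ⟩
  m * q                ∎
  where open ≡-Reasoning

module _ {p q : ℕ} (prime-p : Prime p) (p∣q : p ∣ q) (1≤q : 1 ≤ q) where

  private instance
    p≢0 : NonZero p
    p≢0 = prime⇒nonZero prime-p

  [m*[q∸1]+d]%p≡p∸m+d : ∀ {m d} → m ≤ p → d < m → (m * (q ∸ 1) + d) % p ≡ p ∸ m + d
  [m*[q∸1]+d]%p≡p∸m+d {m} {d} m≤p d<m = begin
    (N + d) % p               ≡⟨ [m+n]%n≡m%n (N + d) p ⟨
    (N + d + p) % p           ≡⟨ cong (λ x → (N + d + x) % p) (m∸n+n≡m m≤p) ⟨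
    (N + d + (p ∸ m + m)) % p ≡⟨ cong (_% p) (regroup N d (p ∸ m) m) ⟩
    (p ∸ m + d + (N + m)) % p ≡⟨ cong (λ x → (p ∸ m + d + x) % p) (m*[q∸1]+m≡m*q m 1≤q) ⟩
    (p ∸ m + d + m * q) % p   ≡⟨ %-remove-+ʳ (p ∸ m + d) (∣n⇒∣m*n m p∣q) ⟩
    (p ∸ m + d) % p           ≡⟨ m<n⇒m%n≡m p∸m+d<p ⟩
    p ∸ m + d                 ∎
    where
      open ≡-Reasoning
      N : ℕ
      N = m * (q ∸ 1)
      regroup : ∀ a b c e → a + b + (c + e) ≡ c + b + (a + e)
      regroup = solve-∀
      p∸m+d<p : p ∸ m + d < p
      p∸m+d<p = subst (p ∸ m + d <_) (m∸n+n≡m m≤p) (+-monoʳ-< (p ∸ m) d<m)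

  p∣[m*[q∸1]+d]Ck⇔p∸m+d<k : ∀ {k d} → suc k ≤ p → d ≤ k →
    p ∣ (suc k * (q ∸ 1) + d) C k ⇔ p ∸ suc k + d < k
  p∣[m*[q∸1]+d]Ck⇔p∸m+d<k {k} {d} m≤p d≤k =
    subst (λ r → p ∣ (suc k * (q ∸ 1) + d) C k ⇔ r < k)
          ([m*[q∸1]+d]%p≡p∸m+d m≤p (s≤s d≤k))
          (p∣nCk⇔n%p<k prime-p _ m≤p)

  IsU-when-m≤p : ∀ {k} → suc k ≤ p → IsU p q (suc k) (base q (suc k) + (k ∸ (p ∸ suc k)))
  IsU-when-m≤p {k} m≤p = m≤m+n _ _ , U-at-threshold , below-threshold
    where
      e : ℕ
      e = p ∸ suc k
      U-at-threshold : UCond p (suc k) (base q (suc k) + (k ∸ e))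
      U-at-threshold = UCond-base+ q (suc k) λ p∣C →
        <⇒≱ (Equivalence.to (p∣[m*[q∸1]+d]Ck⇔p∸m+d<k m≤p (m∸n≤m k e)) p∣C) (m≤n+m∸n k e)
      below-threshold : ∀ t → base q (suc k) ≤ t → t < base q (suc k) + (k ∸ e) →
                        ¬ UCond p (suc k) t
      below-threshold t b≤t t<b+D with m≤n⇒∃[o]m+o≡n b≤t
      ... | d , refl = ¬UCond-base+ q (suc k)
              (Equivalence.from (p∣[m*[q∸1]+d]Ck⇔p∸m+d<k m≤p d≤k) e+d<k)
        where
          d<k∸e : d < k ∸ e
          d<k∸e = +-cancelˡ-< (base q (suc k)) d (k ∸ e) t<b+D
          d≤k : d ≤ k
          d≤k = ≤-trans (<⇒≤ d<k∸e) (m∸n≤m k e)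
          e<k : e < k
          e<k = m∸n≢0⇒n<m (λ k∸e≡0 → n≮0 (subst (d <_) k∸e≡0 d<k∸e))
          e+d<k : e + d < k
          e+d<k = subst (e + d <_) (m+[n∸m]≡n (<⇒≤ e<k)) (+-monoʳ-< e d<k∸e)

  U≡base-when-m+k≤p : ∀ {k u} → IsU p q (suc k) u → suc k + k ≤ p → u ≡ base q (suc k)
  U≡base-when-m+k≤p {k} {u} isU m+k≤p = begin
    u                                      ≡⟨ IsU-unique q (suc k) isU (IsU-when-m≤p m≤p) ⟩
    base q (suc k) + (k ∸ (p ∸ suc k))     ≡⟨ cong (λ x → base q (suc k) + x) (m≤n⇒m∸n≡0 k≤p∸m) ⟩
    base q (suc k) + 0                     ≡⟨ +-identityʳ _ ⟩
    base q (suc k)                         ∎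
    where
      open ≡-Reasoning
      m≤p : suc k ≤ p
      m≤p = ≤-trans (m≤m+n (suc k) k) m+k≤p
      k≤p∸m : k ≤ p ∸ suc k
      k≤p∸m = m+n≤o⇒m≤o∸n k (subst (_≤ p) (+-comm (suc k) k) m+k≤p)

  U≡[mq+m]∸p-when-p≤k+k : ∀ {k u} → IsU p q (suc k) u → suc k ≤ p → p ≤ k + k →
    u ≡ (suc k * q + suc k) ∸ p
  U≡[mq+m]∸p-when-p≤k+k {k} {u} isU m≤p p≤k+k = begin
    u                     ≡⟨ IsU-unique q (suc k) isU (IsU-when-m≤p m≤p) ⟩
    base q m + D          ≡⟨ m+n∸n≡m (base q m + D) p ⟨
    base q m + D + p ∸ p  ≡⟨ cong (_∸ p) sum ⟩
    (m * q + m) ∸ p       ∎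
    where
      open ≡-Reasoning
      m N e D : ℕ
      m = suc k
      N = m * (q ∸ 1)
      e = p ∸ m
      D = k ∸ e
      e≤k : e ≤ k
      e≤k = ≤-trans (∸-monoʳ-≤ p (n≤1+n k)) (m≤n+o⇒m∸n≤o p k p≤k+k)
      regroup : ∀ a b c n → a + 1 + b + (n + c) ≡ a + n + suc (b + c)
      regroup = solve-∀
      sum : base q m + D + p ≡ m * q + m
      sum = begin
        N + 1 + D + p        ≡⟨ cong (λ x → N + 1 + D + x) (m+[n∸m]≡n m≤p) ⟨
        N + 1 + D + (m + e)  ≡⟨ regroup N D e m ⟩
        N + m + suc (D + e)  ≡⟨ cong (λ x → N + m + suc x) (m∸n+n≡m e≤k) ⟩
        N + m + m            ≡⟨ cong (_+ m) (m*[q∸1]+m≡m*q m 1≤q) ⟩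
        m * q + m            ∎

∣+i-+j∣≡∣i-j∣ : ∀ i j → ℤ.∣ + i ℤ.- + j ∣ ≡ ∣ i - j ∣
∣+i-+j∣≡∣i-j∣ i j with ≤-total i j
... | inj₁ i≤j = trans (cong ℤ.∣_∣ (ℤP.m-n≡m⊖n i j))
                   (trans (ℤP.∣⊖∣-≤ i≤j) (sym (m≤n⇒∣m-n∣≡n∸m i≤j)))
... | inj₂ j≤i = trans (cong ℤ.∣_∣ (ℤP.m-n≡m⊖n i j))
                   (trans (ℤP.∣m⊖n∣≡∣n⊖m∣ i j)
                     (trans (ℤP.∣⊖∣-≤ j≤i) (sym (m≤n⇒∣n-m∣≡n∸m j≤i))))

∣a*b-1⇒∤a : ∀ {d} → d ∤ 1 → ∀ a b → + d ℤD.∣ a ℤ.* b ℤ.- + 1 → ¬ (+ d ℤD.∣ a)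
∣a*b-1⇒∤a {d} d∤1 a b d∣ab-1 d∣a = d∤1 (ℤS.∣⇒∣ᵤ {+ d} {+ 1} (ℤS.∣m⇒∣-m d∣-1))
  where
    d∣ab : + d ℤS.∣ a ℤ.* b
    d∣ab = ℤS.∣m⇒∣m*n {m = a} b (ℤS.∣ᵤ⇒∣ {+ d} {a} d∣a)
    d∣-1 : + d ℤS.∣ ℤ.- + 1
    d∣-1 = ℤS.∣m+n∣m⇒∣n (ℤS.∣ᵤ⇒∣ d∣ab-1) d∣ab

module _ {p : ℕ} (prime-p : Prime p) where

  p∣a*b⇔p∣a⊎p∣b : ∀ a b → + p ℤD.∣ a ℤ.* b ⇔ (+ p ℤD.∣ a ⊎ + p ℤD.∣ b)
  p∣a*b⇔p∣a⊎p∣b a b = mk⇔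
    (λ p∣ab → euclidsLemma ℤ.∣ a ∣ ℤ.∣ b ∣ prime-p (subst (p ∣_) (ℤP.abs-* a b) p∣ab))
    (λ p∣a⊎p∣b → subst (p ∣_) (sym (ℤP.abs-* a b)) (case p∣a⊎p∣b))
    where
      case : + p ℤD.∣ a ⊎ + p ℤD.∣ b → p ∣ ℤ.∣ a ∣ * ℤ.∣ b ∣
      case (inj₁ p∣a) = ∣m⇒∣m*n ℤ.∣ b ∣ p∣a
      case (inj₂ p∣b) = ∣n⇒∣m*n ℤ.∣ a ∣ p∣b

  p∤a⇒p∣a*b⇔p∣b : ∀ a b → ¬ (+ p ℤD.∣ a) → + p ℤD.∣ a ℤ.* b ⇔ + p ℤD.∣ b
  p∤a⇒p∣a*b⇔p∣b a b p∤a = mk⇔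
    (λ p∣ab → [ ⊥-elim ∘ p∤a , id ] (Equivalence.to (p∣a*b⇔p∣a⊎p∣b a b) p∣ab))
    (λ p∣b → Equivalence.from (p∣a*b⇔p∣a⊎p∣b a b) (inj₂ p∣b))

  p∣+i-+j⇔i≡j : ∀ {i j} → i < p → j < p → + p ℤD.∣ + i ℤ.- + j ⇔ i ≡ j
  p∣+i-+j⇔i≡j {i} {j} i<p j<p = mk⇔
    (λ p∣ → ∣m-n∣≡0⇒m≡n (multiple-below-p (subst (p ∣_) (∣+i-+j∣≡∣i-j∣ i j) p∣) ∣i-j∣<p))
    (λ { refl → subst (p ∣_) (sym (trans (∣+i-+j∣≡∣i-j∣ i i) (∣n-n∣≡0 i))) (p ∣0) })
    where
      ∣i-j∣<p : ∣ i - j ∣ < p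
      ∣i-j∣<p = ≤-<-trans (∣m-n∣≤m⊔n i j) (⊔-lub i<p j<p)
      multiple-below-p : ∀ {n} → p ∣ n → n < p → n ≡ 0
      multiple-below-p {zero}  _   _   = refl
      multiple-below-p {suc n} p∣n n<p = ⊥-elim (>⇒∤ n<p p∣n)

  p∣prodShift⇔1≤t≤k : ∀ {t} k → t < p → k < p →
    + p ℤD.∣ prodShift (+ t) k ⇔ (1 ≤ t × t ≤ k)
  p∣prodShift⇔1≤t≤k zero t<p _ = mk⇔
    (λ p∣1 → ⊥-elim (p∤1 prime-p p∣1))
    (λ { (1≤t , t≤0) → ⊥-elim (<⇒≱ 1≤t t≤0) })
  p∣prodShift⇔1≤t≤k {t} (suc k) t<p k<p = mk⇔ to from
    where
      product : + p ℤD.∣ prodShift (+ t) (suc k) ⇔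
                (+ p ℤD.∣ prodShift (+ t) k ⊎ + p ℤD.∣ + t ℤ.- + suc k)
      product = p∣a*b⇔p∣a⊎p∣b (prodShift (+ t) k) (+ t ℤ.- + suc k)
      IH : + p ℤD.∣ prodShift (+ t) k ⇔ (1 ≤ t × t ≤ k)
      IH = p∣prodShift⇔1≤t≤k k t<p (<-trans (n<1+n k) k<p)
      factor : + p ℤD.∣ + t ℤ.- + suc k ⇔ t ≡ suc k
      factor = p∣+i-+j⇔i≡j t<p k<p
      to : + p ℤD.∣ prodShift (+ t) (suc k) → 1 ≤ t × t ≤ suc k
      to p∣ with Equivalence.to product p∣
      ... | inj₁ p∣prod = map₂ m≤n⇒m≤1+n (Equivalence.to IH p∣prod)
      ... | inj₂ p∣t-k with Equivalence.to factor p∣t-k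
      ...   | refl = s≤s z≤n , ≤-refl
      from : 1 ≤ t × t ≤ suc k → + p ℤD.∣ prodShift (+ t) (suc k)
      from (1≤t , t≤1+k) with m≤n⇒m<n∨m≡n t≤1+k
      ... | inj₁ (s≤s t≤k) = Equivalence.from product (inj₁ (Equivalence.from IH (1≤t , t≤k)))
      ... | inj₂ refl     = Equivalence.from product (inj₂ (Equivalence.from factor refl))

  roots-of-c*prodShift : ∀ {k} c → k < p → + p ℤD.∣ c ℤ.* + (k !) ℤ.- + 1 →
    ∀ {t} → t < p → + p ℤD.∣ c ℤ.* prodShift (+ t) k ⇔ (1 ≤ t × t ≤ k)
  roots-of-c*prodShift {k} c k<p p∣c*k!-1 {t} t<p =
    p∣prodShift⇔1≤t≤k k t<p k<p ⇔-∘ p∤a⇒p∣a*b⇔p∣b c (prodShift (+ t) k) p∤c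
    where
      p∤c : ¬ (+ p ℤD.∣ c)
      p∤c = ∣a*b-1⇒∤a (p∤1 prime-p) c (+ (k !)) p∣c*k!-1

2*[1+k]∸1≡1+k+k : ∀ k → 2 * suc k ∸ 1 ≡ suc k + k
2*[1+k]∸1≡1+k+k k = trans (cong (λ x → k + x) (+-identityʳ (suc k))) (+-suc k k)

2*[1+k]∸2≡k+k : ∀ k → 2 * suc k ∸ 2 ≡ k + k
2*[1+k]∸2≡k+k k = cong (_∸ 1) (2*[1+k]∸1≡1+k+k k)

proposition6 : (m p α : ℕ) → 1 ≤ m → Prime p → 1 ≤ α →
    -- (1) U(q,m) exists and m(q-1)+1 ≤ U(q,m) ≤ mq
    (∃ λ u → IsU p (p ^ α) m u) ×
    (∀ u → IsU p (p ^ α) m u → base (p ^ α) m ≤ u × u ≤ m * p ^ α) ×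
    -- (2)
    (∀ u → IsU p (p ^ α) m u → 2 * m ∸ 1 ≤ p → u ≡ base (p ^ α) m) ×
    -- (3)
    (∀ u → IsU p (p ^ α) m u → m ≤ p → p ≤ 2 * m ∸ 2 → u ≡ (m * p ^ α + m) ∸ p) ×
    -- (4) with c an inverse of (m-1)! mod p, the roots in Z_p of
    --     c·(t-1)(t-2)...(t-(m-1)) are exactly 1,...,m-1
    (m ≤ p → ∀ (c : ℤ) → (+ p) ℤD.∣ (c ℤ.* + ((m ∸ 1) !) ℤ.- + 1) →
      ∀ (t : Fin p) →
        ((+ p) ℤD.∣ (c ℤ.* prodShift (+ toℕ t) (m ∸ 1)) ⇔ (1 ≤ toℕ t × toℕ t ≤ m ∸ 1)))
proposition6 zero    _ _       ()  _       _
proposition6 (suc k) p zero    _   _       ()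
proposition6 (suc k) p (suc β) _   prime-p _ =
    IsU-exists (p∤1 prime-p) q k
  , (λ u isU → proj₁ isU , subst (u ≤_) base+k≡mq (IsU⇒≤base+k (p∤1 prime-p) q k isU))
  , (λ u isU 2m∸1≤p → U≡base-when-m+k≤p prime-p p∣q 1≤q {k} isU
                        (subst (_≤ p) (2*[1+k]∸1≡1+k+k k) 2m∸1≤p))
  , (λ u isU m≤p p≤2m∸2 → U≡[mq+m]∸p-when-p≤k+k prime-p p∣q 1≤q {k} isU m≤p
                            (subst (p ≤_) (2*[1+k]∸2≡k+k k) p≤2m∸2))
  , (λ m≤p c p∣c*k!-1 t → roots-of-c*prodShift prime-p c m≤p p∣c*k!-1 (toℕ<n t))
  where
    instance
      p≢0 : NonZero p
      p≢0 = prime⇒nonZero prime-p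
    q : ℕ
    q = p ^ suc β
    p∣q : p ∣ q
    p∣q = m∣m*n (p ^ β)
    1≤q : 1 ≤ q
    1≤q = m^n>0 p (suc β)
    base+k≡mq : base q (suc k) + k ≡ suc k * q
    base+k≡mq = trans (+-assoc (suc k * (q ∸ 1)) 1 k) (m*[q∸1]+m≡m*q (suc k) 1≤q)
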